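{- Let $A_1,\ldots,A_n$ be the datatypes involved in the functions of $\mathbb F$. Suppose $\mathbb F$ contains some function $\omega:B_1\times\cdots\times B_\ell\to B_i$ (with $1\le i\le\ell$) and some constants $\nu_1\in B_1,\ldots,\nu_\ell\in B_\ell$. Let $\tau:\{1,\ldots,k\}\to\{1,\ldots,n\}$. For $j=1,\ldots,k$, let $\varphi_j$ be a good $\mathbb F$-term with variables $x_i$ for $i\in I_j\subseteq\{1,\ldots,k\}$ such that $[\![\varphi_j]\!]=f_j:\prod_{i\in I_j}A_{\tau(i)}\to A_{\tau(j)}$. Then there exist constants $K_{\min}$ and $L_{\min}$ such that for all $K\ge K_{\min}$ and $L\ge L_{\min}$ there exists a $\lambda$-term $\theta$ such that: 1. using the leftmost reduction strategy, for all $(a_1,\ldots,a_k)\in A_{\tau(1)}\times\cdots\times A_{\tau(k)}$, writing $\vec a_I=(a_j)_{j\in I}$, $\theta\,\ulcorner a_1\urcorner\cdots\ulcorner a_k\urcorner\twoheadrightarrow\theta\,\ulcorner f_1(\vec a_{I_1})\urcorner\cdots\ulcorner f_k(\vec a_{I_k})\urcorner$; 2. this sequence of reductions consists of $K$ $\beta$-reductions and $L$ $\mathbb F$-reductions.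
   Context: $\mathbb F$ is a family of functions over datatypes $A_1,\ldots,A_n$, each element $a$ coded by a closed normal $\lambda$-term $\ulcorner a\urcorner$. $\Lambda_{\mathbb F}$-terms are built from variables and constants $c_f$ ($f\in\mathbb F$) by abstraction and application; one-step reduction is $\beta$-reduction or $\mathbb F$-reduction $c_f\ulcorner a_1\urcorner\cdots\ulcorner a_k\urcorner\to\ulcorner f(a_1,\ldots,a_k)\urcorner$, in any subterm; $\twoheadrightarrow$ is the reflexive transitive closure. The leftmost strategy reduces the leftmost $\mathbb F$-redex if any, else the leftmost $\beta$-redex. Good $\mathbb F$-terms: built (from typed variables, then with typed variables replaced injectively by untyped ones) as $c_f\,t_1\cdots t_k$ with $f:A_{i_1}\times\cdots\times A_{i_k}\to A_q$ in $\mathbb F$ and each $t_j$ a variable of type $A_{i_j}$ or a good $\mathbb F$-term of value type $A_{i_j}$; the semantics $[\![\cdot]\!]$ is the function of the variables obtained by composing the functions of $\mathbb F$ accordingly. The variable $x_i$ is of type $A_{\tau(i)}$. -}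

module Defs where

open import Data.Nat using (ℕ; zero; suc)
open import Data.Fin using (Fin; zero; suc)
open import Data.List using (List; []; _∷_; foldl; tabulate)
open import Data.Unit using (⊤; tt)
open import Data.Product using (Σ; _×_; _,_)
open import Relation.Nullary using (¬_)
open import Relation.Binary.PropositionalEquality using (_≡_)

data Term (C : Set) : ℕ → Set where
  var : ∀ {m} → Fin m → Term C m
  con : ∀ {m} → C → Term C m
  lam : ∀ {m} → Term C (suc m) → Term C m
  app : ∀ {m} → Term C m → Term C m → Term C m

module _ {C : Set} where

  ext : ∀ {m m'} → (Fin m → Fin m') → Fin (suc m) → Fin (suc m')
  ext ρ zero    = zero
  ext ρ (suc i) = suc (ρ i)

  ren : ∀ {m m'} → (Fin m → Fin m') → Term C m → Term C m'
  ren ρ (var i)   = var (ρ i)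
  ren ρ (con c)   = con c
  ren ρ (lam t)   = lam (ren (ext ρ) t)
  ren ρ (app t u) = app (ren ρ t) (ren ρ u)

  exts : ∀ {m m'} → (Fin m → Term C m') → Fin (suc m) → Term C (suc m')
  exts σ zero    = var zero
  exts σ (suc i) = ren suc (σ i)

  sub : ∀ {m m'} → (Fin m → Term C m') → Term C m → Term C m'
  sub σ (var i)   = σ i
  sub σ (con c)   = con c
  sub σ (lam t)   = lam (sub (exts σ) t)
  sub σ (app t u) = app (sub σ t) (sub σ u)

  single : ∀ {m} → Term C m → Fin (suc m) → Term C m
  single u zero    = u
  single u (suc i) = var i

  _[_] : ∀ {m} → Term C (suc m) → Term C m → Term C m
  t [ u ] = sub (single u) t

  close : ∀ {m} → Term C 0 → Term C m
  close = ren (λ ())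

  applyAll : ∀ {m} → Term C m → List (Term C m) → Term C m
  applyAll = foldl app

  data NoConst : ∀ {m} → Term C m → Set where
    var : ∀ {m} (i : Fin m) → NoConst (var i)
    lam : ∀ {m} {t : Term C (suc m)} → NoConst t → NoConst (lam t)
    app : ∀ {m} {t u : Term C m} → NoConst t → NoConst u → NoConst (app t u)

  data HasB : ∀ {m} → Term C m → Set where
    here : ∀ {m} {t : Term C (suc m)} {u : Term C m} → HasB (app (lam t) u)
    inL  : ∀ {m} {t u : Term C m} → HasB t → HasB (app t u)
    inR  : ∀ {m} {t u : Term C m} → HasB u → HasB (app t u)
    inλ  : ∀ {m} {t : Term C (suc m)} → HasB t → HasB (lam t)

  BetaNormal : ∀ {m} → Term C m → Set
  BetaNormal t = ¬ HasB t

  data IsLam : ∀ {m} → Term C m → Set where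
    isLam : ∀ {m} {t : Term C (suc m)} → IsLam (lam t)

  data LB : ∀ {m} → Term C m → Term C m → Set where
    top  : ∀ {m} {t : Term C (suc m)} {u : Term C m} → LB (app (lam t) u) (t [ u ])
    appL : ∀ {m} {u u' v : Term C m} → ¬ IsLam u → LB u u' → LB (app u v) (app u' v)
    appR : ∀ {m} {u v v' : Term C m} → ¬ IsLam u → ¬ HasB u → LB v v' → LB (app u v) (app u v')
    lamR : ∀ {m} {t t' : Term C (suc m)} → LB t t' → LB (lam t) (lam t')

Args : ∀ {n} → (Fin n → Set) → List (Fin n) → Set
Args A []       = ⊤
Args A (d ∷ ds) = A d × Args A ds

-- Functions of arity 0 (dom f ≡ []) are the constants of 𝔽.

record Family : Set₁ where
  field
    n     : ℕ
    A     : Fin n → Set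
    Fn    : Set
    dom   : Fn → List (Fin n)
    cod   : Fn → Fin n
    sem   : (f : Fn) → Args A (dom f) → A (cod f)
    code  : ∀ {i} → A i → Term Fn 0
    code-pure   : ∀ {i} (a : A i) → NoConst (code a)
    code-normal : ∀ {i} (a : A i) → BetaNormal (code a)
    code-inj    : ∀ {i} (a b : A i) → code a ≡ code b → a ≡ b

module _ (F : Family) where
  open Family F

  codes : ∀ {m} (ds : List (Fin n)) → Args A ds → List (Term Fn m)
  codes []       tt       = []
  codes (d ∷ ds) (a , as) = close (code a) ∷ codes ds as

  data TopF {m} : Term Fn m → Term Fn m → Set where
    fred : (f : Fn) (as : Args A (dom f)) →
           TopF (applyAll (con f) (codes (dom f) as)) (close (code (sem f as)))

  IsTopF : ∀ {m} → Term Fn m → Set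
  IsTopF {m} t = Σ (Term Fn m) (λ t' → TopF t t')

  data HasF : ∀ {m} → Term Fn m → Set where
    here : ∀ {m} {t t' : Term Fn m} → TopF t t' → HasF t
    inL  : ∀ {m} {t u : Term Fn m} → HasF t → HasF (app t u)
    inR  : ∀ {m} {t u : Term Fn m} → HasF u → HasF (app t u)
    inλ  : ∀ {m} {t : Term Fn (suc m)} → HasF t → HasF (lam t)

  data LF : ∀ {m} → Term Fn m → Term Fn m → Set where
    top  : ∀ {m} {t t' : Term Fn m} → TopF t t' → LF t t'
    appL : ∀ {m} {u u' v : Term Fn m} → ¬ IsTopF (app u v) → LF u u' → LF (app u v) (app u' v)
    appR : ∀ {m} {u v v' : Term Fn m} → ¬ IsTopF (app u v) → ¬ HasF u → LF v v' →
           LF (app u v) (app u v')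
    lamR : ∀ {m} {t t' : Term Fn (suc m)} → LF t t' → LF (lam t) (lam t')

  -- one step of the leftmost strategy: leftmost 𝔽-redex if any, else leftmost β-redex
  data LStepβ {m} : Term Fn m → Term Fn m → Set where
    βstep : ∀ {t t'} → ¬ HasF t → LB t t' → LStepβ t t'

  data _⟶ₗ*⟨_,_⟩_ {m} : Term Fn m → ℕ → ℕ → Term Fn m → Set where
    done  : ∀ {t} → t ⟶ₗ*⟨ 0 , 0 ⟩ t
    stepβ : ∀ {t t' t'' K L} → LStepβ t t' → t' ⟶ₗ*⟨ K , L ⟩ t'' → t ⟶ₗ*⟨ suc K , L ⟩ t''
    stepF : ∀ {t t' t'' K L} → LF t t' → t' ⟶ₗ*⟨ K , L ⟩ t'' → t ⟶ₗ*⟨ K , suc L ⟩ t''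

  module _ {k : ℕ} (τ : Fin k → Fin n) where
    mutual
      data Good : Fin n → Set where
        gapp : (f : Fn) → GoodArgs (dom f) → Good (cod f)

      data GoodArgs : List (Fin n) → Set where
        []   : GoodArgs []
        _∷v_ : ∀ {ds} (i : Fin k) → GoodArgs ds → GoodArgs (τ i ∷ ds)
        _∷g_ : ∀ {d ds} → Good d → GoodArgs ds → GoodArgs (d ∷ ds)

    mutual
      ⟦_⟧ : ∀ {q} → Good q → ((i : Fin k) → A (τ i)) → A q
      ⟦ gapp f ts ⟧ ρ = sem f (⟦ ts ⟧s ρ)

      ⟦_⟧s : ∀ {ds} → GoodArgs ds → ((i : Fin k) → A (τ i)) → Args A ds
      ⟦ [] ⟧s ρ       = tt
      ⟦ i ∷v ts ⟧s ρ  = ρ i , ⟦ ts ⟧s ρ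
      ⟦ t ∷g ts ⟧s ρ  = ⟦ t ⟧ ρ , ⟦ ts ⟧s ρ

  applyCodes : ∀ {k} {τ : Fin k → Fin n} → Term Fn 0 → ((i : Fin k) → A (τ i)) → Term Fn 0
  applyCodes θ a = applyAll θ (tabulate (λ i → code (a i)))

-- θ is a fixed point W W in the style of Turing's combinator, with
--   W = λw. λx₁ ⋯ x_k. Iᵖ (D (w w φ₁ ⋯ φ_k))   and   D = (λz. (λx y. y) (ωᵐ z)) ⌜ν_i⌝,
-- so after consuming its k arguments θ ⌜a₁⌝ ⋯ ⌜a_k⌝ has become Iᵖ (D (θ ⌜f₁(a)⌝ ⋯ ⌜f_k(a)⌝)).
-- Between two of these k β-steps the leftmost strategy contracts every F-redex of the φⱼ whose
-- arguments have all become codes. The term reached is the residual of the φⱼ, in which each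
-- subterm over already substituted variables is replaced by the code of its value, and the number
-- of contractions depends only on which variables are substituted, not on their values.
-- The identities Iᵖ cost p further β-steps, and D, which iterates ω m times on a constant before
-- discarding the result, costs 3 β-steps and m F-steps; so K = k + 4 + p and L = Lmin + m.

module Submission where

open import Defs
open import Data.Nat using (ℕ; _≥_)
open import Data.Fin using (Fin)
open import Data.List using (List; []; length; lookup)
open import Data.Product using (Σ; _×_; _,_)
open import Relation.Binary.PropositionalEquality using (_≡_)

open import Data.Nat using (zero; suc; _+_; _∸_; _<_; s≤s; z≤n)
open import Data.Nat.Properties using (+-identityʳ; +-comm; +-assoc; m<m+n; <-irrefl; m+[n∸m]≡n)
open import Data.Nat.ListAction using (sum)
open import Data.Fin using (zero; suc)
open import Data.List using (_∷_; _++_; map; tabulate)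
open import Data.List.Properties using (++-assoc; ++-identityʳ; length-++; tabulate-cong; map-tabulate)
open import Data.List.Relation.Unary.All using (All; []; _∷_)
open import Data.List.Relation.Unary.All.Properties using (tabulate⁺; Any¬⇒¬All)
open import Data.List.Relation.Unary.Any using (Any; here; there)
open import Data.List.Relation.Unary.Any.Properties using (++⁺ˡ; ++⁺ʳ)
open import Data.Maybe using (Maybe; just; nothing; zip; is-just; is-nothing) renaming (map to mapᴹ)
open import Data.Bool using (Bool; true; false; _∨_)
open import Data.Product using (proj₁; proj₂)
open import Data.Sum using (_⊎_; inj₁; inj₂)
open import Data.Unit using (⊤; tt)
open import Relation.Nullary using (¬_)
open import Function using (_∘_)
open import Data.Nat.Tactic.RingSolver using (solve-∀)
open import Relation.Binary.PropositionalEquality using (refl; sym; trans; cong; cong₂; subst; subst₂)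

module _ {C : Set} where

  exts-cong : ∀ {m m'} {σ σ' : Fin m → Term C m'} → (∀ i → σ i ≡ σ' i) → ∀ i → exts σ i ≡ exts σ' i
  exts-cong h zero    = refl
  exts-cong h (suc i) = cong (ren suc) (h i)

  sub-cong : ∀ {m m'} {σ σ' : Fin m → Term C m'} → (∀ i → σ i ≡ σ' i) → (t : Term C m) → sub σ t ≡ sub σ' t
  sub-cong h (var i)   = h i
  sub-cong h (con c)   = refl
  sub-cong h (lam t)   = cong lam (sub-cong (exts-cong h) t)
  sub-cong h (app t u) = cong₂ app (sub-cong h t) (sub-cong h u)

  sub-ren : ∀ {m m' m''} (σ : Fin m' → Term C m'') (ρ : Fin m → Fin m') (t : Term C m) →
            sub σ (ren ρ t) ≡ sub (σ ∘ ρ) t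
  sub-ren σ ρ (var i)   = refl
  sub-ren σ ρ (con c)   = refl
  sub-ren σ ρ (lam t)   = cong lam (trans (sub-ren (exts σ) (ext {C = C} ρ) t) (sub-cong (λ { zero → refl ; (suc i) → refl }) t))
  sub-ren σ ρ (app t u) = cong₂ app (sub-ren σ ρ t) (sub-ren σ ρ u)

  sub-var : ∀ {m m'} {σ : Fin m → Term C m'} {ρ : Fin m → Fin m'} → (∀ i → σ i ≡ var (ρ i)) →
            (t : Term C m) → sub σ t ≡ ren ρ t
  sub-var h (var i)   = h i
  sub-var h (con c)   = refl
  sub-var h (lam t)   = cong lam (sub-var (λ { zero → refl ; (suc i) → cong (ren suc) (h i) }) t)
  sub-var h (app t u) = cong₂ app (sub-var h t) (sub-var h u)

  ren-id : ∀ {m} {ρ : Fin m → Fin m} → (∀ i → ρ i ≡ i) → (t : Term C m) → ren ρ t ≡ t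
  ren-id h (var i)   = cong var (h i)
  ren-id h (con c)   = refl
  ren-id h (lam t)   = cong lam (ren-id (λ { zero → refl ; (suc i) → cong suc (h i) }) t)
  ren-id h (app t u) = cong₂ app (ren-id h t) (ren-id h u)

  close-id : (c : Term C 0) → close c ≡ c
  close-id = ren-id (λ ())

  Closed : (∀ {m} → Term C m) → Set
  Closed t = ∀ {m m'} (σ : Fin m → Term C m') → sub σ (t {m}) ≡ t {m'}

  close-closed : (c : Term C 0) → Closed (close c)
  close-closed c σ = trans (sub-ren σ (λ ()) c) (sub-var (λ ()) c)

  ren-closed : ∀ {t : ∀ {m} → Term C m} → Closed t → ∀ {m m'} (ρ : Fin m → Fin m') → ren ρ (t {m}) ≡ t
  ren-closed {t} cl ρ = trans (sym (sub-var (λ _ → refl) t)) (cl (var ∘ ρ))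

  sub-applyAll : ∀ {m m'} (σ : Fin m → Term C m') (h : Term C m) (xs : List (Term C m)) →
                 sub σ (applyAll h xs) ≡ applyAll (sub σ h) (map (sub σ) xs)
  sub-applyAll σ h []       = refl
  sub-applyAll σ h (x ∷ xs) = sub-applyAll σ (app h x) xs

  spineHead : ∀ {m} → Term C m → Term C m
  spineHead (app u v) = spineHead u
  spineHead t         = t

  spineArgs : ∀ {m} → Term C m → List (Term C m)
  spineArgs (app u v) = spineArgs u ++ v ∷ []
  spineArgs t         = []

  spineHead-applyAll : ∀ {m} (h : Term C m) xs → spineHead (applyAll h xs) ≡ spineHead h
  spineHead-applyAll h []       = refl
  spineHead-applyAll h (x ∷ xs) = spineHead-applyAll (app h x) xs

  spineArgs-applyAll : ∀ {m} (h : Term C m) xs → spineArgs (applyAll h xs) ≡ spineArgs h ++ xs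
  spineArgs-applyAll h []       = sym (++-identityʳ (spineArgs h))
  spineArgs-applyAll h (x ∷ xs) = trans (spineArgs-applyAll (app h x) xs) (++-assoc (spineArgs h) (x ∷ []) xs)

-- r ⊕ m is r + m, computed so that Fin (suc r ⊕ m) and Fin (r ⊕ suc m) coincide definitionally:
-- the body of r nested binders over scope m lives in scope r ⊕ m, and the outermost binder peels off.
_⊕_ : ℕ → ℕ → ℕ
zero  ⊕ m = m
suc r ⊕ m = r ⊕ suc m

outer : ∀ r {m} → Fin m → Fin (r ⊕ m)
outer zero    i = i
outer (suc r) i = outer r (suc i)

binder : ∀ r {m} → Fin r → Fin (r ⊕ m)
binder (suc r) zero    = outer r zero
binder (suc r) (suc l) = binder r l

module _ {C : Set} where

  lams : ∀ r {m} → Term C (r ⊕ m) → Term C m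
  lams zero    t = t
  lams (suc r) t = lam (lams r t)

  extsⁿ : ∀ r {m m'} → (Fin m → Term C m') → Fin (r ⊕ m) → Term C (r ⊕ m')
  extsⁿ zero    σ = σ
  extsⁿ (suc r) σ = extsⁿ r (exts σ)

  sub-lams : ∀ r {m m'} (σ : Fin m → Term C m') (t : Term C (r ⊕ m)) → sub σ (lams r t) ≡ lams r (sub (extsⁿ r σ) t)
  sub-lams zero    σ t = refl
  sub-lams (suc r) σ t = cong lam (sub-lams r (exts σ) t)

  extsⁿ-outer-closed : ∀ r {t : ∀ {m} → Term C m} → Closed t → ∀ {m m'} {σ : Fin m → Term C m'} {i} →
                       σ i ≡ t → extsⁿ r σ (outer r i) ≡ t
  extsⁿ-outer-closed zero    cl e = e
  extsⁿ-outer-closed (suc r) cl e = extsⁿ-outer-closed r cl (trans (cong (ren suc) e) (ren-closed cl suc))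

  extsⁿ-outer-var : ∀ r {m m'} {σ : Fin m → Term C m'} {i j} → σ i ≡ var j → extsⁿ r σ (outer r i) ≡ var (outer r j)
  extsⁿ-outer-var zero    e = e
  extsⁿ-outer-var (suc r) e = extsⁿ-outer-var r (cong (ren suc) e)

  extsⁿ-binder : ∀ r {m m'} (σ : Fin m → Term C m') (l : Fin r) → extsⁿ r σ (binder r l) ≡ var (binder r l)
  extsⁿ-binder (suc r) σ zero    = extsⁿ-outer-var r refl
  extsⁿ-binder (suc r) σ (suc l) = extsⁿ-binder r (exts σ) l

  lams-cong : ∀ r (P : ∀ {m} → Term C m → Term C m → Set) → (∀ {m} {u u' : Term C (suc m)} → P u u' → P (lam u) (lam u')) →
              ∀ {m} {t t' : Term C (r ⊕ m)} → P t t' → P (lams r t) (lams r t')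
  lams-cong zero    P c p = p
  lams-cong (suc r) P c p = c (lams-cong r P c p)

module _ {X Y : Set} where

  zip-nothing : (x : Maybe X) (y : Maybe Y) → zip x y ≡ nothing → x ≡ nothing ⊎ y ≡ nothing
  zip-nothing (just _) nothing  _ = inj₂ refl
  zip-nothing nothing  _        _ = inj₁ refl

  zip-just : (x : Maybe X) (y : Maybe Y) {a : X} {b : Y} → zip x y ≡ just (a , b) → x ≡ just a × y ≡ just b
  zip-just (just _) (just _) refl = refl , refl

  is-nothing-zip : (x : Maybe X) (y : Maybe Y) → is-nothing (zip x y) ≡ is-nothing x ∨ is-nothing y
  is-nothing-zip (just _) (just _) = refl
  is-nothing-zip (just _) nothing  = refl
  is-nothing-zip nothing  _        = refl

  map-nothing⁻ : (f : X → Y) (x : Maybe X) → mapᴹ f x ≡ nothing → x ≡ nothing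
  map-nothing⁻ f nothing _ = refl

  is-nothing-map : (f : X → Y) (x : Maybe X) → is-nothing (mapᴹ f x) ≡ is-nothing x
  is-nothing-map f (just _) = refl
  is-nothing-map f nothing  = refl

module _ (F : Family) where
  open Family F

  private
    Tm : ℕ → Set
    Tm = Term Fn

  FNormal : ∀ {m} → Tm m → Set
  FNormal t = ¬ HasF F t

  IsCode : ∀ {m} → Tm m → Set
  IsCode {m} t = Σ (Fin n) (λ d → Σ (A d) (λ v → t ≡ close (code v)))

  noConst-ren : ∀ {m m'} (ρ : Fin m → Fin m') {t : Tm m} → NoConst t → NoConst (ren ρ t)
  noConst-ren ρ (var i)   = var (ρ i)
  noConst-ren ρ (lam p)   = lam (noConst-ren _ p)
  noConst-ren ρ (app p q) = app (noConst-ren ρ p) (noConst-ren ρ q)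

  noConst-code : ∀ {m d} (v : A d) → NoConst {m = m} (close (code v))
  noConst-code v = noConst-ren _ (code-pure v)

  ¬noConst-applyAll-con : ∀ {m} f (xs : List (Tm m)) → ¬ NoConst (applyAll (con f) xs)
  ¬noConst-applyAll-con f xs = impure-head (con f) xs λ ()
    where
      impure-head : ∀ {m} (h : Tm m) xs → ¬ NoConst h → ¬ NoConst (applyAll h xs)
      impure-head h []       ¬h = ¬h
      impure-head h (x ∷ xs) ¬h = impure-head (app h x) xs λ { (app p _) → ¬h p }

  ¬code-var : ∀ {m} (i : Fin m) → ¬ IsCode (var i)
  ¬code-var i (d , v , e) = closed-not-var (code v) (sym e)
    where
      closed-not-var : (c : Tm 0) → ¬ (close c ≡ var i)
      closed-not-var (var ())
      closed-not-var (con _)   ()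
      closed-not-var (lam _)   ()
      closed-not-var (app _ _) ()

  ¬code-impure : ∀ {m} {t : Tm m} → ¬ NoConst t → ¬ IsCode t
  ¬code-impure ¬p (d , v , refl) = ¬p (noConst-code v)

  codes-isCode : ∀ {m} ds (as : Args A ds) → All IsCode (codes F {m} ds as)
  codes-isCode []       tt       = []
  codes-isCode (d ∷ ds) (a , as) = (d , a , refl) ∷ codes-isCode ds as

  length-codes : ∀ {m} ds (as : Args A ds) → length (codes F {m} ds as) ≡ length ds
  length-codes []       tt       = refl
  length-codes (d ∷ ds) (a , as) = cong suc (length-codes ds as)

  hasF-impure : ∀ {m} {t : Tm m} → HasF F t → ¬ NoConst t
  hasF-impure (here (fred f as)) p         = ¬noConst-applyAll-con f (codes F (dom f) as) p
  hasF-impure (inL h)            (app p q) = hasF-impure h p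
  hasF-impure (inR h)            (app p q) = hasF-impure h q
  hasF-impure (inλ h)            (lam p)   = hasF-impure h p

  normal-pure : ∀ {m} {t : Tm m} → NoConst t → FNormal t
  normal-pure p h = hasF-impure h p

  normal-code : ∀ {m d} (v : A d) → FNormal {m} (close (code v))
  normal-code v = normal-pure (noConst-code v)

  LF-hasF : ∀ {m} {t t' : Tm m} → LF F t t' → HasF F t
  LF-hasF (top r)       = here r
  LF-hasF (appL _ l)    = inL (LF-hasF l)
  LF-hasF (appR _ _ l)  = inR (LF-hasF l)
  LF-hasF (lamR l)      = inλ (LF-hasF l)

  LF-¬code : ∀ {m} {t t' : Tm m} → LF F t t' → ¬ IsCode t
  LF-¬code l = ¬code-impure (hasF-impure (LF-hasF l))

  redex-spine : ∀ {m} {t : Tm m} → IsTopF F t →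
                Σ Fn (λ f → Σ (Args A (dom f)) (λ as → (spineHead t ≡ con f) × (spineArgs t ≡ codes F (dom f) as)))
  redex-spine (_ , fred f as) = f , as , spineHead-applyAll (con f) (codes F (dom f) as) , spineArgs-applyAll (con f) (codes F (dom f) as)

  -- When the head is a λ or a variable, λ f () proves this, since spineHead computes.
  NoConHead : ∀ {m} → Tm m → Set
  NoConHead t = ∀ f → ¬ (spineHead t ≡ con f)

  ¬redex-head : ∀ {m} {t : Tm m} → NoConHead t → ¬ IsTopF F t
  ¬redex-head nc r with redex-spine r
  ... | f , _ , eh , _ = nc f eh

  ¬redex-arg : ∀ {m} {t : Tm m} → Any (¬_ ∘ IsCode) (spineArgs t) → ¬ IsTopF F t
  ¬redex-arg an r with redex-spine r
  ... | _ , as , _ , ea = Any¬⇒¬All an (subst (All IsCode) (sym ea) (codes-isCode _ as))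

  ¬redex-partial : ∀ {m} {t : Tm m} {f} → spineHead t ≡ con f → length (spineArgs t) < length (dom f) → ¬ IsTopF F t
  ¬redex-partial eh lt r with redex-spine r
  ... | g , as , eh' , ea with trans (sym eh) eh'
  ... | refl = <-irrefl (trans (cong length ea) (length-codes _ as)) lt

  normal-app : ∀ {m} {u v : Tm m} → FNormal u → FNormal v → ¬ IsTopF F (app u v) → FNormal (app u v)
  normal-app nu nv nt (here r) = nt (_ , r)
  normal-app nu nv nt (inL h)  = nu h
  normal-app nu nv nt (inR h)  = nv h

  normal-lam : ∀ {m} {t : Tm (suc m)} → FNormal t → FNormal (lam t)
  normal-lam nt (here r) = ¬redex-head (λ f ()) (_ , r)
  normal-lam nt (inλ h)  = nt h

  normal-lams : ∀ r {m} {t : Tm (r ⊕ m)} → FNormal t → FNormal (lams r t)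
  normal-lams zero    nt = nt
  normal-lams (suc r) nt = normal-lam (normal-lams r nt)

  normal-con : ∀ {m} f → 0 < length (dom f) → FNormal {m} (con f)
  normal-con f lt (here r) = ¬redex-partial refl lt (_ , r)

  NoRedexPrefix : ∀ {m} → Tm m → List (Tm m) → Set
  NoRedexPrefix h []       = ⊤
  NoRedexPrefix h (x ∷ xs) = ¬ IsTopF F (app h x) × NoRedexPrefix (app h x) xs

  normal-applyAll : ∀ {m} (h : Tm m) xs → FNormal h → All FNormal xs → NoRedexPrefix h xs → FNormal (applyAll h xs)
  normal-applyAll h []       nh []         _          = nh
  normal-applyAll h (x ∷ xs) nh (nx ∷ nxs) (nt , nts) = normal-applyAll (app h x) xs (normal-app nh nx nt) nxs nts

  noRedexPrefix-inert : ∀ {m} (h : Tm m) xs → NoConHead h → NoRedexPrefix h xs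
  noRedexPrefix-inert h []       nc = tt
  noRedexPrefix-inert h (x ∷ xs) nc = ¬redex-head nc , noRedexPrefix-inert (app h x) xs nc

  normal-applyAll-inert : ∀ {m} (h : Tm m) xs → NoConHead h → FNormal h → All FNormal xs → FNormal (applyAll h xs)
  normal-applyAll-inert h xs nc nh nxs = normal-applyAll h xs nh nxs (noRedexPrefix-inert h xs nc)

  arity-snoc : ∀ {m} (h : Tm m) x xs {d} → length (spineArgs h) + length (x ∷ xs) ≡ d →
               length (spineArgs (app h x)) + length xs ≡ d
  arity-snoc h x xs e = trans (trans (cong (_+ length xs) (length-++ (spineArgs h))) (+-assoc (length (spineArgs h)) 1 (length xs))) e

  ¬redex-unsaturated : ∀ {m} (h : Tm m) x y ys {f} → spineHead h ≡ con f →
                       length (spineArgs h) + length (x ∷ y ∷ ys) ≡ length (dom f) → ¬ IsTopF F (app h x)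
  ¬redex-unsaturated h x y ys eh e =
    ¬redex-partial eh (subst (_ <_) (arity-snoc h x (y ∷ ys) e) (m<m+n _ (s≤s z≤n)))

  noRedexPrefix-partial : ∀ {m} (h : Tm m) xs {f} → spineHead h ≡ con f → length (spineArgs h) + length xs ≡ length (dom f) →
                          Any (¬_ ∘ IsCode) (spineArgs h ++ xs) → NoRedexPrefix h xs
  noRedexPrefix-partial h []          eh e an = tt
  noRedexPrefix-partial h (x ∷ [])    eh e an = ¬redex-arg an , tt
  noRedexPrefix-partial h (x ∷ y ∷ xs) eh e an =
    ¬redex-unsaturated h x y xs eh e ,
    noRedexPrefix-partial (app h x) (y ∷ xs) eh (arity-snoc h x (y ∷ xs) e)
      (subst (Any (¬_ ∘ IsCode)) (sym (++-assoc (spineArgs h) (x ∷ []) (y ∷ xs))) an)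

  normal-stuck-node : ∀ {m} f (xs : List (Tm m)) → length xs ≡ length (dom f) →
                      Any (¬_ ∘ IsCode) xs → All FNormal xs → FNormal (applyAll (con f) xs)
  normal-stuck-node {m} f xs e an nxs =
    normal-applyAll (con f) xs (normal-con f (subst (0 <_) e (nonempty an))) nxs (noRedexPrefix-partial (con f) xs refl e an)
    where
      nonempty : ∀ {ys : List (Tm m)} → Any (¬_ ∘ IsCode) ys → 0 < length ys
      nonempty (here _)  = s≤s z≤n
      nonempty (there _) = s≤s z≤n

  PrefixesNormal : ∀ {m} → Tm m → List (Tm m) → Set
  PrefixesNormal h []       = ⊤
  PrefixesNormal h (y ∷ ys) = FNormal h × PrefixesNormal (app h y) ys

  prefixesNormal-inert : ∀ {m} (h : Tm m) ys → NoConHead h → FNormal h → All FNormal ys → PrefixesNormal h ys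
  prefixesNormal-inert h []       nc nh _          = tt
  prefixesNormal-inert h (y ∷ ys) nc nh (ny ∷ nys) = nh , prefixesNormal-inert (app h y) ys nc (normal-app nh ny (¬redex-head nc)) nys

  prefixesNormal-node : ∀ {m} (h : Tm m) ys {f} → spineHead h ≡ con f → length (spineArgs h) + length ys ≡ length (dom f) →
                        FNormal h → All FNormal ys → PrefixesNormal h ys
  prefixesNormal-node h []           eh e nh _          = tt
  prefixesNormal-node h (y ∷ [])     eh e nh _          = nh , tt
  prefixesNormal-node h (y ∷ z ∷ ys) eh e nh (ny ∷ nys) =
    nh , prefixesNormal-node (app h y) (z ∷ ys) eh (arity-snoc h y (z ∷ ys) e)
           (normal-app nh ny (¬redex-unsaturated h y z ys eh e)) nys

  prefixesNormal-con : ∀ {m} f (ys : List (Tm m)) → length ys ≡ length (dom f) → All FNormal ys → PrefixesNormal (con f) ys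
  prefixesNormal-con f []       e _   = tt
  prefixesNormal-con f (y ∷ ys) e nys = prefixesNormal-node (con f) (y ∷ ys) refl e (normal-con f (subst (0 <_) e (s≤s z≤n))) nys

  infix 4 _↠⟨_,_⟩_
  _↠⟨_,_⟩_ : ∀ {m} → Tm m → ℕ → ℕ → Tm m → Set
  t ↠⟨ K , L ⟩ t' = _⟶ₗ*⟨_,_⟩_ F t K L t'

  infixr 5 _▸_
  _▸_ : ∀ {m} {t t' t'' : Tm m} {K₁ L₁ K₂ L₂} →
        t ↠⟨ K₁ , L₁ ⟩ t' → t' ↠⟨ K₂ , L₂ ⟩ t'' → t ↠⟨ K₁ + K₂ , L₁ + L₂ ⟩ t''
  done      ▸ r = r
  stepβ s p ▸ r = stepβ s (p ▸ r)
  stepF s p ▸ r = stepF s (p ▸ r)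

  F-contract : ∀ {m} f (as : Args A (dom f)) → applyAll {m = m} (con f) (codes F (dom f) as) ↠⟨ 0 , 1 ⟩ close (code (sem f as))
  F-contract f as = stepF (top (fred f as)) done

  β-step : ∀ {m} {t t' t'' : Tm m} {K L} → FNormal t → LB t t' → t' ↠⟨ K , L ⟩ t'' → t ↠⟨ suc K , L ⟩ t''
  β-step nt b = stepβ (βstep nt b)

  lift-F : ∀ {m m'} (C : Tm m → Tm m') → (∀ {u u'} → LF F u u' → LF F (C u) (C u')) →
           ∀ {u u' L} → u ↠⟨ 0 , L ⟩ u' → C u ↠⟨ 0 , L ⟩ C u'
  lift-F C c done        = done
  lift-F C c (stepF s p) = stepF (c s) (lift-F C c p)

  LF-spine : ∀ {m} {u u' : Tm m} xs → LF F u u' → Any (¬_ ∘ IsCode) (spineArgs u) → LF F (applyAll u xs) (applyAll u' xs)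
  LF-spine []       l an = l
  LF-spine (x ∷ xs) l an = LF-spine xs (appL (¬redex-arg (++⁺ˡ an)) l) (++⁺ˡ an)

  LF-inert : ∀ {m} {u u' : Tm m} xs → LF F u u' → NoConHead u → LF F (applyAll u xs) (applyAll u' xs)
  LF-inert []       l nc = l
  LF-inert (x ∷ xs) l nc = LF-inert xs (appL (¬redex-head nc) l) nc

  LF-arg : ∀ {m} {h x x' : Tm m} xs → FNormal h → LF F x x' → LF F (applyAll (app h x) xs) (applyAll (app h x') xs)
  LF-arg {h = h} xs nh l = LF-spine xs (appR (¬redex-arg last) nh l) last
    where last = ++⁺ʳ (spineArgs h) (here (LF-¬code l))

  LB-spine : ∀ {m} {u u' : Tm m} xs → ¬ IsLam u → LB u u' → LB (applyAll u xs) (applyAll u' xs)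
  LB-spine []       nl b = b
  LB-spine (x ∷ xs) nl b = LB-spine xs (λ ()) (appL nl b)

  data ArgSteps {m} : List (Tm m) → ℕ → List (Tm m) → Set where
    []  : ArgSteps [] 0 []
    _∷_ : ∀ {x l y xs L ys} → x ↠⟨ 0 , l ⟩ y → ArgSteps xs L ys → ArgSteps (x ∷ xs) (l + L) (y ∷ ys)

  argSteps-refl : ∀ {m} (xs : List (Tm m)) → ArgSteps xs 0 xs
  argSteps-refl []       = []
  argSteps-refl (x ∷ xs) = done ∷ argSteps-refl xs

  argSteps-tabulate : ∀ {m k} {f g : Fin k → Tm m} {l : Fin k → ℕ} → (∀ j → f j ↠⟨ 0 , l j ⟩ g j) →
                      ArgSteps (tabulate f) (sum (tabulate l)) (tabulate g)
  argSteps-tabulate {k = zero}  r = []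
  argSteps-tabulate {k = suc k} r = r zero ∷ argSteps-tabulate (r ∘ suc)

  reduce-args : ∀ {m} (h : Tm m) {xs L ys} → ArgSteps xs L ys → PrefixesNormal h ys → applyAll h xs ↠⟨ 0 , L ⟩ applyAll h ys
  reduce-args h []                     _         = done
  reduce-args h (_∷_ {y = y} {xs} r s) (nh , ps) = lift-F (λ w → applyAll (app h w) xs) (LF-arg xs nh) r ▸ reduce-args (app h y) s ps

  module _ {k : ℕ} (τ : Fin k → Fin n) where

    -- A shape e : Fin k → Maybe (Fin r) says, for each variable xᵢ, whether it is still bound
    -- by the l-th of r pending binders (just l) or already known (nothing); in the latter case a
    -- valuation val supplies its value.
    Valuation : ∀ {r} → (Fin k → Maybe (Fin r)) → Set
    Valuation e = (i : Fin k) → e i ≡ nothing → A (τ i)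

    assigned : ((i : Fin k) → A (τ i)) → ∀ {r} {e : Fin k → Maybe (Fin r)} → Valuation e
    assigned a i _ = a i

    Agrees : ((i : Fin k) → A (τ i)) → ∀ {r} {e : Fin k → Maybe (Fin r)} → Valuation e → Set
    Agrees a val = ∀ i p → val i p ≡ a i

    slotValue : ∀ {r} {X : Set} (x : Maybe (Fin r)) → (x ≡ nothing → X) → Maybe X
    slotValue (just _) v = nothing
    slotValue nothing  v = just (v refl)

    slotTerm : ∀ {r m d} → (Fin r → Fin m) → (x : Maybe (Fin r)) → (x ≡ nothing → A d) → Tm m
    slotTerm P (just l) v = var (P l)
    slotTerm P nothing  v = close (code (v refl))

    node : ∀ {m} f → Maybe (Args A (dom f)) → List (Tm m) → Tm m
    node f (just as) xs = close (code (sem f as))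
    node f nothing   xs = applyAll (con f) xs

    hasPending : ∀ {r ds} → (Fin k → Maybe (Fin r)) → GoodArgs F τ ds → Bool
    hasPending e []                = false
    hasPending e (i ∷v ts)         = is-just (e i) ∨ hasPending e ts
    hasPending e (gapp f us ∷g ts) = hasPending e us ∨ hasPending e ts

    tally : Bool → Bool → ℕ → ℕ
    tally false _     c = 0
    tally true  true  c = c
    tally true  false c = c + 1

    -- The number of F-contractions that turn the residual for shape e into the one for e'.
    mutual
      contractions : ∀ {r r' q} → (Fin k → Maybe (Fin r)) → (Fin k → Maybe (Fin r')) → Good F τ q → ℕ
      contractions e e' (gapp f ts) = tally (hasPending e ts) (hasPending e' ts) (contractionsArgs e e' ts)

      contractionsArgs : ∀ {r r' ds} → (Fin k → Maybe (Fin r)) → (Fin k → Maybe (Fin r')) → GoodArgs F τ ds → ℕ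
      contractionsArgs e e' []        = 0
      contractionsArgs e e' (i ∷v ts) = contractionsArgs e e' ts
      contractionsArgs e e' (t ∷g ts) = contractions e e' t + contractionsArgs e e' ts

    module Evaluation {r} (e : Fin k → Maybe (Fin r)) (val : Valuation e) where
      mutual
        value : ∀ {q} → Good F τ q → Maybe (A q)
        value (gapp f ts) = mapᴹ (sem f) (values ts)

        values : ∀ {ds} → GoodArgs F τ ds → Maybe (Args A ds)
        values []        = just tt
        values (i ∷v ts) = zip (slotValue (e i) (val i)) (values ts)
        values (t ∷g ts) = zip (value t) (values ts)

      hasPending-values : ∀ {ds} (ts : GoodArgs F τ ds) → hasPending e ts ≡ is-nothing (values ts)
      hasPending-values []                = refl
      hasPending-values (i ∷v ts)         =
        trans (cong₂ _∨_ (sym (is-nothing-slotValue (e i) (val i))) (hasPending-values ts))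
              (sym (is-nothing-zip (slotValue (e i) (val i)) (values ts)))
        where
          is-nothing-slotValue : ∀ {X : Set} (x : Maybe (Fin r)) (v : x ≡ nothing → X) → is-nothing (slotValue x v) ≡ is-just x
          is-nothing-slotValue (just _) v = refl
          is-nothing-slotValue nothing  v = refl
      hasPending-values (gapp f us ∷g ts) =
        trans (cong₂ _∨_ (trans (hasPending-values us) (sym (is-nothing-map (sem f) (values us)))) (hasPending-values ts))
              (sym (is-nothing-zip (value (gapp f us)) (values ts)))

    -- The residual of a good term: every subterm whose variables are all known is replaced by
    -- the code of its value; a pending variable number l is the variable P l.
    module Residual {r m} (e : Fin k → Maybe (Fin r)) (P : Fin r → Fin m) (val : Valuation e) where
      open Evaluation e val public

      mutual
        residual : ∀ {q} → Good F τ q → Tm m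
        residual (gapp f ts) = node f (values ts) (residuals ts)

        residuals : ∀ {ds} → GoodArgs F τ ds → List (Tm m)
        residuals []        = []
        residuals (i ∷v ts) = slotTerm P (e i) (val i) ∷ residuals ts
        residuals (t ∷g ts) = residual t ∷ residuals ts

      length-residuals : ∀ {ds} (ts : GoodArgs F τ ds) → length (residuals ts) ≡ length ds
      length-residuals []        = refl
      length-residuals (i ∷v ts) = cong suc (length-residuals ts)
      length-residuals (t ∷g ts) = cong suc (length-residuals ts)

      normal-slot : ∀ {d} (x : Maybe (Fin r)) (v : x ≡ nothing → A d) → FNormal (slotTerm P x v)
      normal-slot (just l) v = normal-pure (var (P l))
      normal-slot nothing  v = normal-code (v refl)

      mutual
        residual-stuck : ∀ {q} (t : Good F τ q) → value t ≡ nothing → ¬ IsCode (residual t)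
        residual-stuck (gapp f ts) eq with values ts | map-nothing⁻ (sem f) (values ts) eq
        ... | nothing | refl = ¬code-impure (¬noConst-applyAll-con f (residuals ts))

        residuals-stuck : ∀ {ds} (ts : GoodArgs F τ ds) → values ts ≡ nothing → Any (¬_ ∘ IsCode) (residuals ts)
        residuals-stuck (i ∷v ts) eq with zip-nothing (slotValue (e i) (val i)) (values ts) eq
        ... | inj₁ eq' = here (slot-stuck (e i) (val i) eq')
          where
            slot-stuck : ∀ {d} (x : Maybe (Fin r)) (v : x ≡ nothing → A d) → slotValue x v ≡ nothing → ¬ IsCode (slotTerm P x v)
            slot-stuck (just l) v _ = ¬code-var (P l)
        ... | inj₂ eq' = there (residuals-stuck ts eq')
        residuals-stuck (t ∷g ts) eq with zip-nothing (value t) (values ts) eq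
        ... | inj₁ eq' = here (residual-stuck t eq')
        ... | inj₂ eq' = there (residuals-stuck ts eq')

      mutual
        residual-code : ∀ {q} (t : Good F τ q) {b} → value t ≡ just b → residual t ≡ close (code b)
        residual-code (gapp f ts) eq with values ts
        residual-code (gapp f ts) refl | just as = refl

        residuals-codes : ∀ {ds} (ts : GoodArgs F τ ds) {bs} → values ts ≡ just bs → residuals ts ≡ codes F ds bs
        residuals-codes []        refl = refl
        residuals-codes (i ∷v ts) eq with zip-just (slotValue (e i) (val i)) (values ts) eq
        ... | eq₁ , eq₂ = cong₂ _∷_ (slot-code (e i) (val i) eq₁) (residuals-codes ts eq₂)
          where
            slot-code : ∀ {d} (x : Maybe (Fin r)) (v : x ≡ nothing → A d) {b} →
                        slotValue x v ≡ just b → slotTerm P x v ≡ close (code b)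
            slot-code nothing v refl = refl
        residuals-codes (t ∷g ts) eq with zip-just (value t) (values ts) eq
        ... | eq₁ , eq₂ = cong₂ _∷_ (residual-code t eq₁) (residuals-codes ts eq₂)

      mutual
        normal-residual : ∀ {q} (t : Good F τ q) → FNormal (residual t)
        normal-residual (gapp f ts) with values ts in eq
        ... | just as = normal-code (sem f as)
        ... | nothing = normal-stuck-node f (residuals ts) (length-residuals ts) (residuals-stuck ts eq) (normal-residuals ts)

        normal-residuals : ∀ {ds} (ts : GoodArgs F τ ds) → All FNormal (residuals ts)
        normal-residuals []        = []
        normal-residuals (i ∷v ts) = normal-slot (e i) (val i) ∷ normal-residuals ts
        normal-residuals (t ∷g ts) = normal-residual t ∷ normal-residuals ts

    sub-residual : ∀ {r m m'} (e : Fin k → Maybe (Fin r)) {P : Fin r → Fin m} {P' : Fin r → Fin m'} (val : Valuation e)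
                   (σ : Fin m → Tm m') → (∀ l → σ (P l) ≡ var (P' l)) →
                   ∀ {q} (t : Good F τ q) → sub σ (Residual.residual e P val t) ≡ Residual.residual e P' val t
    sub-residual e {P} {P'} val σ hyp = residual-sub
      where
        open Evaluation e val
        module S = Residual e P val
        module T = Residual e P' val

        slot-sub : ∀ {d} (x : Maybe _) (v : x ≡ nothing → A d) → sub σ (slotTerm P x v) ≡ slotTerm P' x v
        slot-sub (just l) v = hyp l
        slot-sub nothing  v = close-closed (code (v refl)) σ

        mutual
          residual-sub : ∀ {q} (t : Good F τ q) → sub σ (S.residual t) ≡ T.residual t
          residual-sub (gapp f ts) with values ts
          ... | just as = close-closed (code (sem f as)) σ
          ... | nothing = trans (sub-applyAll σ (con f) (S.residuals ts)) (cong (applyAll (con f)) (residuals-sub ts))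

          residuals-sub : ∀ {ds} (ts : GoodArgs F τ ds) → map (sub σ) (S.residuals ts) ≡ T.residuals ts
          residuals-sub []        = refl
          residuals-sub (i ∷v ts) = cong₂ _∷_ (slot-sub (e i) (val i)) (residuals-sub ts)
          residuals-sub (t ∷g ts) = cong₂ _∷_ (residual-sub t) (residuals-sub ts)

    slotValue-mono : ∀ {r r'} {X : Set} (x : Maybe (Fin r)) (x' : Maybe (Fin r')) {v : x ≡ nothing → X} {v' : x' ≡ nothing → X} →
                     (∀ p p' → v p ≡ v' p') → (x ≡ nothing → x' ≡ nothing) →
                     ∀ {b} → slotValue x v ≡ just b → slotValue x' v' ≡ just b
    slotValue-mono nothing nothing  agree mono refl = cong just (sym (agree refl refl))
    slotValue-mono nothing (just _) agree mono refl with mono refl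
    ... | ()

    module Refine (a : (i : Fin k) → A (τ i)) {r r'} (e : Fin k → Maybe (Fin r)) (e' : Fin k → Maybe (Fin r'))
                  (val : Valuation e) (val-a : Agrees a val) (mono : ∀ i → e i ≡ nothing → e' i ≡ nothing) where
      module E  = Evaluation e val
      module E' = Evaluation e' (assigned a)

      mutual
        value-mono : ∀ {q} (t : Good F τ q) {b} → E.value t ≡ just b → E'.value t ≡ just b
        value-mono (gapp f ts) eq with E.values ts in eq₁
        value-mono (gapp f ts) refl | just as rewrite values-mono ts eq₁ = refl

        values-mono : ∀ {ds} (ts : GoodArgs F τ ds) {bs} → E.values ts ≡ just bs → E'.values ts ≡ just bs
        values-mono []        eq = eq
        values-mono (i ∷v ts) eq with zip-just (slotValue (e i) (val i)) (E.values ts) eq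
        ... | eq₁ , eq₂ rewrite slotValue-mono (e i) (e' i) (λ p _ → val-a i p) (mono i) eq₁ | values-mono ts eq₂ = refl
        values-mono (t ∷g ts) eq with zip-just (E.value t) (E.values ts) eq
        ... | eq₁ , eq₂ rewrite value-mono t eq₁ | values-mono ts eq₂ = refl

      module _ {m m'} (P : Fin r → Fin m) (P' : Fin r' → Fin m') (σ : Fin m → Tm m')
               (slot-step : ∀ i → sub σ (slotTerm P (e i) (val i)) ≡ slotTerm P' (e' i) (λ _ → a i)) where
        module R  = Residual e P val
        module R' = Residual e' P' (assigned a)

        mutual
          residual-step : ∀ {q} (t : Good F τ q) → sub σ (R.residual t) ↠⟨ 0 , contractions e e' t ⟩ R'.residual t
          residual-step (gapp f ts) rewrite E.hasPending-values ts | E'.hasPending-values ts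
            with E.values ts in eq₁ | E'.values ts in eq₂
          ... | just as | just bs with trans (sym (values-mono ts eq₁)) eq₂
          ...   | refl = subst (_↠⟨ 0 , 0 ⟩ _) (sym (close-closed (code (sem f as)) σ)) done
          residual-step (gapp f ts) | just as | nothing with trans (sym (values-mono ts eq₁)) eq₂
          ... | ()
          residual-step (gapp f ts) | nothing | nothing = reduce-node f ts
          residual-step (gapp f ts) | nothing | just bs =
            reduce-node f ts ▸ subst (λ xs → applyAll (con f) xs ↠⟨ 0 , 1 ⟩ _) (sym (R'.residuals-codes ts eq₂)) (F-contract f bs)

          residuals-step : ∀ {ds} (ts : GoodArgs F τ ds) → ArgSteps (map (sub σ) (R.residuals ts)) (contractionsArgs e e' ts) (R'.residuals ts)
          residuals-step []        = []
          residuals-step (i ∷v ts) = subst (_ ↠⟨ 0 , 0 ⟩_) (slot-step i) done ∷ residuals-step ts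
          residuals-step (t ∷g ts) = residual-step t ∷ residuals-step ts

          reduce-node : ∀ f (ts : GoodArgs F τ (dom f)) →
                        sub σ (applyAll (con f) (R.residuals ts)) ↠⟨ 0 , contractionsArgs e e' ts ⟩ applyAll (con f) (R'.residuals ts)
          reduce-node f ts = subst (_↠⟨ 0 , _ ⟩ _) (sym (sub-applyAll σ (con f) (R.residuals ts)))
            (reduce-args (con f) (residuals-step ts) (prefixesNormal-con f (R'.residuals ts) (R'.length-residuals ts) (R'.normal-residuals ts)))

    module Complete (a : (i : Fin k) → A (τ i)) (e : Fin k → Maybe (Fin 0)) (val : Valuation e) (val-a : Agrees a val) where
      open Evaluation e val

      mutual
        value-complete : ∀ {q} (t : Good F τ q) → value t ≡ just (⟦_⟧ F τ t a)
        value-complete (gapp f ts) rewrite values-complete ts = refl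

        values-complete : ∀ {ds} (ts : GoodArgs F τ ds) → values ts ≡ just (⟦_⟧s F τ ts a)
        values-complete []        = refl
        values-complete (i ∷v ts) with e i | val i | val-a i
        ... | nothing | v | v-a rewrite values-complete ts | v-a refl = refl
        values-complete (t ∷g ts) rewrite value-complete t | values-complete ts = refl

      residual-complete : ∀ {m} (P : Fin 0 → Fin m) {q} (t : Good F τ q) → Residual.residual e P val t ≡ close (code (⟦_⟧ F τ t a))
      residual-complete P t = Residual.residual-code e P val t (value-complete t)

  tuple : ∀ ds → ((p : Fin (length ds)) → A (lookup ds p)) → Args A ds
  tuple []       g = tt
  tuple (d ∷ ds) g = g zero , tuple ds (g ∘ suc)

  update : ∀ ds (i : Fin (length ds)) → A (lookup ds i) → ((p : Fin (length ds)) → A (lookup ds p)) → Args A ds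
  update (d ∷ ds) zero    b g = b , tuple ds (g ∘ suc)
  update (d ∷ ds) (suc i) b g = g zero , update ds i b (g ∘ suc)

  fillArgs : ∀ {m} ds (i : Fin (length ds)) → Tm m → ((p : Fin (length ds)) → A (lookup ds p)) → List (Tm m)
  fillArgs (d ∷ ds) zero    t g = t ∷ codes F ds (tuple ds (g ∘ suc))
  fillArgs (d ∷ ds) (suc i) t g = close (code (g zero)) ∷ fillArgs ds i t (g ∘ suc)

  fillArgs-code : ∀ {m} ds i b g → fillArgs {m} ds i (close (code b)) g ≡ codes F ds (update ds i b g)
  fillArgs-code (d ∷ ds) zero    b g = refl
  fillArgs-code (d ∷ ds) (suc i) b g = cong (close (code (g zero)) ∷_) (fillArgs-code ds i b (g ∘ suc))

  sub-codes : ∀ {m m'} (σ : Fin m → Tm m') ds (as : Args A ds) → map (sub σ) (codes F ds as) ≡ codes F ds as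
  sub-codes σ []       tt       = refl
  sub-codes σ (d ∷ ds) (a , as) = cong₂ _∷_ (close-closed (code a) σ) (sub-codes σ ds as)

  sub-fillArgs : ∀ {m m'} (σ : Fin m → Tm m') ds i t g → map (sub σ) (fillArgs ds i t g) ≡ fillArgs ds i (sub σ t) g
  sub-fillArgs σ (d ∷ ds) zero    t g = cong (sub σ t ∷_) (sub-codes σ ds (tuple ds (g ∘ suc)))
  sub-fillArgs σ (d ∷ ds) (suc i) t g = cong₂ _∷_ (close-closed (code (g zero)) σ) (sub-fillArgs σ ds i t (g ∘ suc))

  length-fillArgs : ∀ {m} ds i (t : Tm m) g → length (fillArgs ds i t g) ≡ length ds
  length-fillArgs (d ∷ ds) zero    t g = cong suc (length-codes ds (tuple ds (g ∘ suc)))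
  length-fillArgs (d ∷ ds) (suc i) t g = cong suc (length-fillArgs ds i t (g ∘ suc))

  normal-codes : ∀ {m} ds (as : Args A ds) → All FNormal (codes F {m} ds as)
  normal-codes []       tt       = []
  normal-codes (d ∷ ds) (a , as) = normal-code a ∷ normal-codes ds as

  normal-fillArgs : ∀ {m} ds i {t : Tm m} g → FNormal t → All FNormal (fillArgs ds i t g)
  normal-fillArgs (d ∷ ds) zero    g nt = nt ∷ normal-codes ds (tuple ds (g ∘ suc))
  normal-fillArgs (d ∷ ds) (suc i) g nt = normal-code (g zero) ∷ normal-fillArgs ds i (g ∘ suc) nt

  stuck-fillArgs : ∀ {m} ds i {t : Tm m} g → ¬ IsCode t → Any (¬_ ∘ IsCode) (fillArgs ds i t g)
  stuck-fillArgs (d ∷ ds) zero    g nt = here nt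
  stuck-fillArgs (d ∷ ds) (suc i) g nt = there (stuck-fillArgs ds i (g ∘ suc) nt)

  argSteps-fillArgs : ∀ {m} ds i {t t' : Tm m} {j} g → t ↠⟨ 0 , j ⟩ t' → ArgSteps (fillArgs ds i t g) j (fillArgs ds i t' g)
  argSteps-fillArgs (d ∷ ds) zero {j = j} g r = subst (λ l → ArgSteps _ l _) (+-identityʳ j) (r ∷ argSteps-refl _)
  argSteps-fillArgs (d ∷ ds) (suc i)      g r = done ∷ argSteps-fillArgs ds i (g ∘ suc) r

  code-subst : ∀ {d d'} (eq : d ≡ d') (x : A d) → code (subst A eq x) ≡ code x
  code-subst refl x = refl

  module Iterate (ω : Fn) (i : Fin (length (dom ω))) (cod-ω : cod ω ≡ lookup (dom ω) i)
                 (ν : (p : Fin (length (dom ω))) → A (lookup (dom ω) p)) where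

    B : Set
    B = A (lookup (dom ω) i)

    ωⁿ : ∀ {m} → ℕ → Tm m → Tm m
    ωⁿ zero    t = t
    ωⁿ (suc j) t = applyAll (con ω) (fillArgs (dom ω) i (ωⁿ j t) ν)

    sub-ωⁿ : ∀ {m m'} (σ : Fin m → Tm m') j t → sub σ (ωⁿ j t) ≡ ωⁿ j (sub σ t)
    sub-ωⁿ σ zero    t = refl
    sub-ωⁿ σ (suc j) t = trans (sub-applyAll σ (con ω) (fillArgs (dom ω) i (ωⁿ j t) ν)) (cong (applyAll (con ω))
      (trans (sub-fillArgs σ (dom ω) i (ωⁿ j t) ν) (cong (λ u → fillArgs (dom ω) i u ν) (sub-ωⁿ σ j t))))

    ωⁿ-reduces : ∀ {m} j (b : B) → Σ B (λ b' → ωⁿ {m} j (close (code b)) ↠⟨ 0 , j ⟩ close (code b'))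
    ωⁿ-reduces zero    b = b , done
    ωⁿ-reduces {m} (suc j) b with ωⁿ-reduces j b
    ... | b' , r = subst A cod-ω (sem ω args) ,
                   subst₂ (λ l u → ωⁿ (suc j) (close (code b)) ↠⟨ 0 , l ⟩ u) (+-comm j 1) (cong close (sym (code-subst cod-ω (sem ω args))))
                          (inner ▸ contract)
      where
        args : Args A (dom ω)
        args = update (dom ω) i b' ν

        inner : ωⁿ (suc j) (close (code b)) ↠⟨ 0 , j ⟩ applyAll (con ω) (fillArgs (dom ω) i (close (code b')) ν)
        inner = reduce-args (con ω) (argSteps-fillArgs (dom ω) i ν r)
                  (prefixesNormal-con ω _ (length-fillArgs (dom ω) i _ ν) (normal-fillArgs (dom ω) i ν (normal-code b')))

        contract : applyAll {m = m} (con ω) (fillArgs (dom ω) i (close (code b')) ν) ↠⟨ 0 , 1 ⟩ close (code (sem ω args))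
        contract = subst (λ xs → applyAll (con ω) xs ↠⟨ 0 , 1 ⟩ close (code (sem ω args))) (sym (fillArgs-code (dom ω) i b' ν))
                         (F-contract ω args)

    normal-ωⁿ : ∀ {m} {t : Tm m} → FNormal t → ¬ IsCode t → ∀ j → FNormal (ωⁿ j t)
    normal-ωⁿ {t = t} nt ¬c j = proj₁ (stuck j)
      where
        stuck : ∀ j → FNormal (ωⁿ j t) × ¬ IsCode (ωⁿ j t)
        stuck zero    = nt , ¬c
        stuck (suc j) = normal-stuck-node ω xs (length-fillArgs (dom ω) i _ ν) (stuck-fillArgs (dom ω) i ν (proj₂ (stuck j)))
                                          (normal-fillArgs (dom ω) i ν (proj₁ (stuck j))) ,
                        ¬code-impure (¬noConst-applyAll-con ω xs)
          where xs = fillArgs (dom ω) i (ωⁿ j t) ν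

  module Construction (ω : Fn) (i₀ : Fin (length (dom ω))) (cod-ω : cod ω ≡ lookup (dom ω) i₀)
                      (ν : (p : Fin (length (dom ω))) → A (lookup (dom ω) p))
                      {k : ℕ} (τ : Fin k → Fin n) (φ : (j : Fin k) → Good F τ (τ j)) where
    open Iterate ω i₀ cod-ω ν

    I : ∀ {m} → Tm m
    I = lam (var zero)

    KI : ∀ {m} → Tm m
    KI = lam (lam (var zero))

    normal-I : ∀ {m} → FNormal (I {m})
    normal-I = normal-pure (lam (var zero))

    normal-KI : ∀ {m} → FNormal (KI {m})
    normal-KI = normal-pure (lam (lam (var zero)))

    idⁿ : ∀ {m} → ℕ → Tm m → Tm m
    idⁿ zero    t = t
    idⁿ (suc p) t = app I (idⁿ p t)

    sub-idⁿ : ∀ {m m'} (σ : Fin m → Tm m') p t → sub σ (idⁿ p t) ≡ idⁿ p (sub σ t)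
    sub-idⁿ σ zero    t = refl
    sub-idⁿ σ (suc p) t = cong (app I) (sub-idⁿ σ p t)

    normal-idⁿ : ∀ {m} p {t : Tm m} → FNormal t → FNormal (idⁿ p t)
    normal-idⁿ zero    nt = nt
    normal-idⁿ (suc p) nt = normal-app normal-I (normal-idⁿ p nt) (¬redex-head (λ f ()))

    LF-idⁿ : ∀ {m} p {t t' : Tm m} → LF F t t' → LF F (idⁿ p t) (idⁿ p t')
    LF-idⁿ zero    l = l
    LF-idⁿ (suc p) l = appR (¬redex-head (λ f ())) normal-I (LF-idⁿ p l)

    idⁿ-reduces : ∀ p {t : Tm 0} → FNormal t → idⁿ p t ↠⟨ p , 0 ⟩ t
    idⁿ-reduces zero    nt = done
    idⁿ-reduces (suc p) nt = β-step (normal-idⁿ (suc p) nt) top (idⁿ-reduces p nt)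

    unknown : Fin k → Maybe (Fin k)
    unknown = just

    noValues : Valuation τ unknown
    noValues i ()

    peel : ∀ {r} → Maybe (Fin (suc r)) → Maybe (Fin r)
    peel nothing        = nothing
    peel (just zero)    = nothing
    peel (just (suc l)) = just l

    slot-peel : ∀ {r d} (c : Tm 0) (x : Maybe (Fin (suc r))) (v : x ≡ nothing → A d) {b} → (∀ p → v p ≡ b) →
                (x ≡ just zero → c ≡ code b) →
                sub (extsⁿ r (single c)) (slotTerm τ (binder (suc r)) x v) ≡ slotTerm τ (binder r) (peel x) (λ _ → b)
    slot-peel {r} c nothing        v v-b inv = trans (close-closed (code (v refl)) _) (cong (close ∘ code) (v-b refl))
    slot-peel {r} c (just zero)    v v-b inv = trans (extsⁿ-outer-closed r (close-closed c) (sym (close-id c))) (cong close (inv refl))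
    slot-peel {r} c (just (suc l)) v v-b inv = extsⁿ-binder r (single c) l

    -- F-contractions performed while the r remaining arguments are consumed, from shape e on.
    contractionsFrom : ∀ r → (Fin k → Maybe (Fin r)) → ℕ
    contractionsFrom zero    e = 0
    contractionsFrom (suc r) e = sum (tabulate (λ j → contractions τ e (peel ∘ e) (φ j))) + contractionsFrom r (peel ∘ e)

    module Padded (pp mm : ℕ) where

      -- discard X ↠ X, in 3 β- and mm F-steps spent on the discarded ωᵐᵐ ⌜ν i₀⌝
      discard : ∀ {m} → Tm m
      discard = app (lam (app KI (ωⁿ mm (var zero)))) (close (code (ν i₀)))

      body : ∀ {m} → Tm m → List (Tm m) → Tm m
      body H xs = idⁿ pp (app discard (applyAll H xs))

      residuals : ∀ {r m} (e : Fin k → Maybe (Fin r)) → Valuation τ e → List (Tm (r ⊕ m))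
      residuals {r} e val = tabulate (λ j → Residual.residual τ e (binder r) val (φ j))

      self : ∀ {m} → Tm (k ⊕ suc m)
      self = var (outer k zero)

      W : ∀ {m} → Tm m
      W = lam (lams k (body (app self self) (residuals unknown noValues)))

      θ : ∀ {m} → Tm m
      θ = app W W

      closed-discard : Closed discard
      closed-discard σ = cong₂ app (cong (λ u → lam (app KI u)) (sub-ωⁿ (exts σ) mm (var zero))) (close-closed (code (ν i₀)) σ)

      sub-body : ∀ {m m'} (σ : Fin m → Tm m') H xs → sub σ (body H xs) ≡ body (sub σ H) (map (sub σ) xs)
      sub-body σ H xs = trans (sub-idⁿ σ pp _) (cong (idⁿ pp) (cong₂ app (closed-discard σ) (sub-applyAll σ H xs)))

      sub-residuals : ∀ {r m m'} (σ : Fin (r ⊕ m) → Tm (r ⊕ m')) → (∀ l → σ (binder r l) ≡ var (binder r l)) →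
                      (e : Fin k → Maybe (Fin r)) (val : Valuation τ e) → map (sub σ) (residuals {m = m} e val) ≡ residuals e val
      sub-residuals σ hyp e val = trans (map-tabulate _ (sub σ)) (tabulate-cong (λ j → sub-residual τ e val σ hyp (φ j)))

      closed-W : Closed W
      closed-W σ = cong lam (trans (sub-lams k (exts σ) _)
        (cong (lams k) (trans (sub-body (extsⁿ k (exts σ)) (app self self) (residuals unknown noValues))
          (cong₂ body (cong₂ app self-fixed self-fixed) (sub-residuals (extsⁿ k (exts σ)) (extsⁿ-binder k (exts σ)) unknown noValues)))))
        where self-fixed = extsⁿ-outer-var k refl

      closed-θ : Closed θ
      closed-θ σ = cong₂ app (closed-W σ) (closed-W σ)

      normal-discard : ∀ {m} → FNormal (discard {m})
      normal-discard = normal-app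
        (normal-lam (normal-app normal-KI (normal-ωⁿ (normal-pure (var zero)) (¬code-var zero) mm) (¬redex-head (λ f ()))))
        (normal-code (ν i₀)) (¬redex-head (λ f ()))

      normal-body : ∀ {m} (H : Tm m) xs → FNormal (applyAll H xs) → FNormal (body H xs)
      normal-body H xs nx = normal-idⁿ pp (normal-app normal-discard nx (¬redex-head (λ f ())))

      normal-residuals : ∀ {r m} (e : Fin k → Maybe (Fin r)) (val : Valuation τ e) → All FNormal (residuals {m = m} e val)
      normal-residuals {r} e val = tabulate⁺ (λ j → Residual.normal-residual τ e (binder r) val (φ j))

      normal-W : ∀ {m} → FNormal (W {m})
      normal-W = normal-lam (normal-lams k (normal-body (app self self) (residuals unknown noValues)
        (normal-applyAll-inert (app self self) (residuals unknown noValues) (λ f ())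
          (normal-app (normal-pure (var _)) (normal-pure (var _)) (¬redex-head (λ f ()))) (normal-residuals unknown noValues))))

      normal-θ : ∀ {m} → FNormal (θ {m})
      normal-θ = normal-app normal-W normal-W (¬redex-head (λ f ()))

      normal-θ-args : ∀ {m} (xs : List (Tm m)) → All FNormal xs → FNormal (applyAll θ xs)
      normal-θ-args xs nxs = normal-applyAll-inert θ xs (λ f ()) normal-θ nxs

      discard-reduces : (X : Tm 0) → FNormal X → app discard X ↠⟨ 3 , mm ⟩ X
      discard-reduces X nX with ωⁿ-reduces {0} mm (ν i₀)
      ... | b , r =
        β-step (normal-app normal-discard nX (¬redex-head (λ f ()))) (appL (λ ()) top)
          (subst₂ (λ u l → app (app KI u) X ↠⟨ 2 , l ⟩ X)
                  (sym (sub-ωⁿ (single (close (code (ν i₀)))) mm (var zero))) (+-identityʳ mm)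
            (lift-F (λ u → app (app KI u) X) (λ l → appL (¬redex-head (λ f ())) (appR (¬redex-head (λ f ())) normal-KI l)) r
             ▸ β-step (normal-app (normal-app normal-KI (normal-code b) (¬redex-head (λ f ()))) nX (¬redex-head (λ f ()))) (appL (λ ()) top)
                 (β-step (normal-app normal-I nX (¬redex-head (λ f ()))) top done)))

      LF-body : ∀ {m} {X X' : Tm m} → LF F X X' → LF F (idⁿ pp (app discard X)) (idⁿ pp (app discard X'))
      LF-body l = LF-idⁿ pp (appR (¬redex-head (λ f ())) normal-discard l)

      LF-frame : ∀ r (cs : Fin r → Tm 0) {X X' : Tm (r ⊕ 0)} → LF F X X' →
                 LF F (applyAll (lams r (idⁿ pp (app discard X))) (tabulate cs)) (applyAll (lams r (idⁿ pp (app discard X'))) (tabulate cs))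
      LF-frame zero    cs l = LF-body l
      LF-frame (suc r) cs l = LF-inert (tabulate cs) (lamR (lams-cong r (LF F) lamR (LF-body l))) (λ f ())

      -- The term reached from θ ⌜a₁⌝ ⋯ ⌜a_k⌝ once k − r arguments are consumed; cs are the r pending ones.
      state : ∀ r (e : Fin k → Maybe (Fin r)) → Valuation τ e → (Fin r → Tm 0) → Tm 0
      state r e val cs = applyAll (lams r (body θ (residuals e val))) (tabulate cs)

      module Run (a : (i : Fin k) → A (τ i)) where

        results : List (Tm 0)
        results = tabulate (λ j → close (code (⟦_⟧ F τ (φ j) a)))

        Matches : ∀ {r} → (Fin k → Maybe (Fin r)) → (Fin r → Tm 0) → Set
        Matches e cs = ∀ i l → e i ≡ just l → cs l ≡ code (a i)

        consume-one : ∀ r (e : Fin k → Maybe (Fin (suc r))) (val : Valuation τ e) (cs : Fin (suc r) → Tm 0) →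
                      Agrees τ a val → Matches e cs → (∀ l → NoConst (cs l)) →
                      state (suc r) e val cs ↠⟨ 1 , sum (tabulate (λ j → contractions τ e (peel ∘ e) (φ j))) ⟩
                      state r (peel ∘ e) (assigned τ a) (cs ∘ suc)
        consume-one r e val cs val-a match pure =
          β-step normal-state (LB-spine (tabulate (cs ∘ suc)) (λ ()) top)
            (subst (λ t → applyAll t (tabulate (cs ∘ suc)) ↠⟨ 0 , _ ⟩ state r (peel ∘ e) (assigned τ a) (cs ∘ suc)) (sym substituted)
              (lift-F (λ X → applyAll (lams r (idⁿ pp (app discard X))) (tabulate (cs ∘ suc))) (LF-frame r (cs ∘ suc))
                (reduce-args θ (argSteps-tabulate step)
                  (prefixesNormal-inert θ _ (λ f ()) normal-θ (normal-residuals (peel ∘ e) (assigned τ a))))))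
          where
            σ : Fin (r ⊕ 1) → Tm (r ⊕ 0)
            σ = extsⁿ r (single (cs zero))

            normal-state : FNormal (state (suc r) e val cs)
            normal-state = normal-applyAll-inert _ (tabulate cs) (λ f ())
              (normal-lam (normal-lams r (normal-body θ (residuals e val) (normal-θ-args _ (normal-residuals e val)))))
              (tabulate⁺ (normal-pure ∘ pure))

            substituted : lams r (body θ (residuals e val)) [ cs zero ] ≡
                          lams r (body θ (tabulate (λ j → sub σ (Residual.residual τ e (binder (suc r)) val (φ j)))))
            substituted = trans (sub-lams r (single (cs zero)) _)
              (cong (lams r) (trans (sub-body σ θ (residuals e val))
                (cong₂ body (closed-θ σ) (map-tabulate (λ j → Residual.residual τ e (binder (suc r)) val (φ j)) (sub σ)))))

            step : ∀ j → sub σ (Residual.residual τ e (binder (suc r)) val (φ j)) ↠⟨ 0 , contractions τ e (peel ∘ e) (φ j) ⟩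
                         Residual.residual τ (peel ∘ e) (binder r) (assigned τ a) (φ j)
            step j = Refine.residual-step τ a e (peel ∘ e) val val-a (λ i → cong peel) (binder (suc r)) (binder r) σ
                       (λ i → slot-peel (cs zero) (e i) (val i) (val-a i) (match i zero)) (φ j)

        consume : ∀ r (e : Fin k → Maybe (Fin r)) (val : Valuation τ e) (cs : Fin r → Tm 0) →
                  Agrees τ a val → Matches e cs → (∀ l → NoConst (cs l)) →
                  state r e val cs ↠⟨ r , contractionsFrom r e ⟩ body θ results
        consume zero e val cs val-a match pure =
          subst (λ xs → body θ (residuals e val) ↠⟨ 0 , 0 ⟩ body θ xs)
                (tabulate-cong (λ j → Complete.residual-complete τ a e val val-a (binder 0) (φ j))) done
        consume (suc r) e val cs val-a match pure =
          consume-one r e val cs val-a match pure ▸ consume r (peel ∘ e) (assigned τ a) (cs ∘ suc) (λ _ _ → refl) match' (pure ∘ suc)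
          where
            match' : Matches (peel ∘ e) (cs ∘ suc)
            match' i l eq with e i in eqᵢ
            match' i l refl | just (suc l') = match i (suc l') eqᵢ

        inputs : List (Tm 0)
        inputs = tabulate (λ i → code (a i))

        run : applyAll θ inputs ↠⟨ suc (k + (pp + 3)) , contractionsFrom k unknown + mm ⟩ applyAll θ (tabulate (λ j → code (⟦_⟧ F τ (φ j) a)))
        run = β-step (normal-θ-args inputs (tabulate⁺ (λ i → normal-pure (code-pure (a i))))) (LB-spine inputs (λ ()) top)
                (subst₂ (λ t xs → applyAll t inputs ↠⟨ k + (pp + 3) , contractionsFrom k unknown + mm ⟩ applyAll θ xs)
                        (sym unfolded) (tabulate-cong (λ j → close-id (code (⟦_⟧ F τ (φ j) a))))
                   (consume k unknown noValues (λ i → code (a i)) (λ i ()) (λ { i .i refl → refl }) (λ i → code-pure (a i))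
                    ▸ idⁿ-reduces pp (normal-app normal-discard normal-results (¬redex-head (λ f ())))
                    ▸ discard-reduces _ normal-results))
          where
            normal-results : FNormal (applyAll θ results)
            normal-results = normal-θ-args results (tabulate⁺ (λ j → normal-code (⟦_⟧ F τ (φ j) a)))

            unfolded : lams k (body (app self self) (residuals unknown noValues)) [ W ] ≡ lams k (body θ (residuals unknown noValues))
            unfolded = trans (sub-lams k (single W) _) (cong (lams k)
              (trans (sub-body (extsⁿ k (single W)) (app self self) (residuals unknown noValues))
                     (cong₂ body (cong₂ app self-W self-W) (sub-residuals (extsⁿ k (single W)) (extsⁿ-binder k (single W)) unknown noValues))))
              where self-W = extsⁿ-outer-closed k closed-W refl

    Kmin Lmin : ℕ
    Kmin = k + 4
    Lmin = contractionsFrom k unknown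

    θ[_,_] : ℕ → ℕ → Tm 0
    θ[ K , L ] = Padded.θ (K ∸ Kmin) (L ∸ Lmin)

    θ-reduces : ∀ {K L} → K ≥ Kmin → L ≥ Lmin → (a : (i : Fin k) → A (τ i)) →
                applyCodes F θ[ K , L ] a ↠⟨ K , L ⟩ applyCodes F θ[ K , L ] (λ j → ⟦_⟧ F τ (φ j) a)
    θ-reduces {K} {L} K≥ L≥ a =
      subst₂ (λ K' L' → applyCodes F θ[ K , L ] a ↠⟨ K' , L' ⟩ applyCodes F θ[ K , L ] (λ j → ⟦_⟧ F τ (φ j) a))
        (trans (count k (K ∸ Kmin)) (m+[n∸m]≡n K≥)) (m+[n∸m]≡n L≥) (Padded.Run.run (K ∸ Kmin) (L ∸ Lmin) a)
      where
        count : ∀ k p → suc (k + (p + 3)) ≡ k + 4 + p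
        count = solve-∀

constantValue : (F : Family) → let open Family F in ∀ {d} → Σ Fn (λ c → (dom c ≡ []) × (cod c ≡ d)) → A d
constantValue F (c , dom-c , cod-c) = subst A cod-c (sem c (subst (Args A) (sym dom-c) tt))
  where open Family F

lemma4p4 : (F : Family) →
    let open Family F in
    (ω : Fn) →
    (Σ (Fin (length (dom ω))) (λ i → cod ω ≡ lookup (dom ω) i)) →
    ((p : Fin (length (dom ω))) →
       Σ Fn (λ ν → (dom ν ≡ []) × (cod ν ≡ lookup (dom ω) p))) →
    (k : ℕ) (τ : Fin k → Fin n) →
    (φ : (j : Fin k) → Good F τ (τ j)) →
    Σ ℕ (λ Kmin → Σ ℕ (λ Lmin →
      (K L : ℕ) → K ≥ Kmin → L ≥ Lmin →
      Σ (Term Fn 0) (λ θ →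
        (a : (i : Fin k) → A (τ i)) →
        _⟶ₗ*⟨_,_⟩_ F (applyCodes F θ a) K L
          (applyCodes F θ (λ j → ⟦_⟧ F τ (φ j) a)))))
lemma4p4 F ω (i₀ , cod-ω) ν k τ φ = Kmin , Lmin , λ K L K≥ L≥ → θ[ K , L ] , θ-reduces K≥ L≥
  where open Construction F ω i₀ cod-ω (constantValue F ∘ ν) τ φ
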